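{- Let $\mathcal{W}=(\mathcal{L},f)$ be a weighted lattice and let $H$ be a coatom of $\mathcal{L}$. Then: (1) $\displaystyle \mathbb{P}(\mathcal{W};z) = z^{f(\mathbf{1})-f(H)}\,\mathbb{P}(\mathcal{W}|_H;z) -\sum_{y \text{ atom},\ y \nleq H } \mathbb{P}(\mathcal{W}/y;z)$; (2) if $H$ is not a flat of $\mathcal{W}$, then $\displaystyle \mathbb{P}(\mathcal{W};z) = \mathbb{P}(\mathcal{W}|_H;z) -\sum_{y \text{ atom},\ y \nleq H } \mathbb{P}(\mathcal{W}/y;z)$.
   Context: $\mathcal{L}$ is a finite modular complemented lattice with least element $\mathbf{0}$ and greatest element $\mathbf{1}$; atoms cover $\mathbf{0}$, coatoms are covered by $\mathbf{1}$; $\mu$ is its Möbius function. A weighted lattice is $\mathcal{W}=(\mathcal{L},f)$ with $f:\mathcal{L}\to\mathbb{N}_0$, $f(\mathbf{0})=0$, $f$ monotone. For $X\le Y$, $\mathcal{W}([X,Y])$ is the weighted lattice on $[X,Y]$ with weight $T\mapsto f(T)-f(X)$; $\mathcal{W}|_Y=\mathcal{W}([\mathbf{0},Y])$, $\mathcal{W}/X=\mathcal{W}([X,\mathbf{1}])$. Characteristic polynomial: $\mathbb{P}(\mathcal{W}([X,Y]);z)=\sum_{A\in[X,Y]}\mu(X,A)z^{f(Y)-f(A)}$. An element $F$ is a flat of $\mathcal{W}$ if $f(A)>f(F)$ for every $A>F$. -}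

module Defs where

open import Data.Nat as ℕ using (ℕ; zero; suc; _∸_)
open import Data.Integer as ℤ using (ℤ; +_; -_; _+_; _-_)
open import Data.List using (List; []; _∷_; length; map; filter; foldr)
open import Data.List.Membership.Propositional using (_∈_)
open import Data.List.Relation.Unary.Unique.Propositional using (Unique)
open import Data.List.Relation.Unary.All as All using (All; all?)
open import Data.Product using (Σ; ∃; _×_; _,_)
open import Data.Sum using (_⊎_)
open import Relation.Binary using (Rel; Decidable)
open import Relation.Binary.PropositionalEquality using (_≡_; _≢_)
open import Relation.Binary.Lattice.Structures using (IsBoundedLattice)
open import Relation.Nullary using (¬_; Dec; yes; no)
open import Relation.Nullary.Decidable using (¬?; _×-dec_; _⊎-dec_; _→-dec_)
open import Level using (0ℓ)

record FiniteModularComplementedLattice : Set₁ where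
  field
    Carrier : Set
    _≤_     : Rel Carrier 0ℓ
    _∨_     : Carrier → Carrier → Carrier
    _∧_     : Carrier → Carrier → Carrier
    𝟏       : Carrier
    𝟎       : Carrier
    isBoundedLattice : IsBoundedLattice _≡_ _≤_ _∨_ _∧_ 𝟏 𝟎
    _≟_     : Decidable (_≡_ {A = Carrier})
    _≤?_    : Decidable _≤_
    elems    : List Carrier
    complete : ∀ x → x ∈ elems
    unique   : Unique elems
    modular  : ∀ x y z → x ≤ z → (x ∨ (y ∧ z)) ≡ ((x ∨ y) ∧ z)
    complemented : ∀ x → ∃ λ y → (x ∧ y) ≡ 𝟎 × (x ∨ y) ≡ 𝟏

  _<_ : Rel Carrier 0ℓ
  x < y = x ≤ y × x ≢ y

  _<?_ : Decidable _<_
  x <? y = (x ≤? y) ×-dec ¬? (x ≟ y)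

  IsAtom : Carrier → Set
  IsAtom y = 𝟎 < y × (∀ z → ¬ (𝟎 < z × z < y))

  atom? : ∀ y → Dec (IsAtom y)
  atom? y with 𝟎 <? y | all? (λ z → ¬? ((𝟎 <? z) ×-dec (z <? y))) elems
  ... | no ¬p | _ = no (λ { (p , _) → ¬p p })
  ... | yes p | yes a = yes (p , λ z → All.lookup a (complete z))
  ... | yes p | no ¬a = no (λ { (_ , q) → ¬a (All.tabulate (λ {z} _ → q z)) })

  IsCoatom : Carrier → Set
  IsCoatom h = h < 𝟏 × (∀ z → ¬ (h < z × z < 𝟏))

  sumℤ : List ℤ → ℤ
  sumℤ = foldr _+_ (+ 0)

  -- Möbius function, by the usual recursion
  --   μ(x,x) = 1,  μ(x,y) = - Σ_{x ≤ z < y} μ(x,z)  (x < y),  μ(x,y) = 0 otherwise,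
  -- computed with fuel; fuel = number of elements exceeds the length of
  -- every chain, so the recursion is fully unfolded.
  möbiusFuel : ℕ → Carrier → Carrier → ℤ
  möbiusFuel k x y with x ≟ y
  ... | yes _ = + 1
  möbiusFuel zero x y | no _ = + 0
  möbiusFuel (suc k) x y | no _ with x ≤? y
  ... | no _ = + 0
  ... | yes _ = - sumℤ (map (möbiusFuel k x)
                             (filter (λ z → (x ≤? z) ×-dec (z <? y)) elems))

  μ : Carrier → Carrier → ℤ
  μ = möbiusFuel (length elems)

open FiniteModularComplementedLattice public

-- Polynomials in z with integer coefficients, as coefficient functions
-- (p k = coefficient of z^k); two polynomials are equal iff all
-- coefficients agree.

Poly : Set
Poly = ℕ → ℤ

_≈P_ : Poly → Poly → Set
p ≈P q = ∀ k → p k ≡ q k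

_⊖_ : Poly → Poly → Poly
(p ⊖ q) k = p k - q k

_⊕_ : Poly → Poly → Poly
(p ⊕ q) k = p k + q k

𝟘P : Poly
𝟘P k = + 0

z^_·_ : ℕ → Poly → Poly
(z^ m · p) k with k ℕ.<? m
... | yes _ = + 0
... | no _  = p (k ∸ m)

ΣP : List Poly → Poly
ΣP = foldr _⊕_ 𝟘P

record Weighting (L : FiniteModularComplementedLattice) : Set where
  field
    f        : Carrier L → ℕ
    f-𝟎      : f (𝟎 L) ≡ 0
    monotone : ∀ {x y} → _≤_ L x y → f x ℕ.≤ f y

open Weighting public

module _ (L : FiniteModularComplementedLattice) (W : Weighting L) where

  -- P(W([X,Y]); z) = Σ_{A ∈ [X,Y]} μ(X,A) z^{f(Y) - f(A)}
  -- (the weight of [X,Y] is T ↦ f T - f X, so the exponent is f Y - f A;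
  --  A ≤ Y so f A ≤ f Y and truncated subtraction is exact)
  charPoly : Carrier L → Carrier L → Poly
  charPoly X Y k =
    sumℤ L (map (μ L X)
      (filter (λ A → ((_≤?_ L X A) ×-dec (_≤?_ L A Y)) ×-dec (f W Y ∸ f W A ℕ.≟ k)) (elems L)))

  P : Poly
  P = charPoly (𝟎 L) (𝟏 L)

  P-restrict : Carrier L → Poly
  P-restrict Y = charPoly (𝟎 L) Y

  P-contract : Carrier L → Poly
  P-contract X = charPoly X (𝟏 L)

  IsFlat : Carrier L → Set
  IsFlat F = ∀ A → _<_ L F A → f W F ℕ.< f W A

  sumAtomsNotBelow : Carrier L → Poly
  sumAtomsNotBelow H =
    ΣP (map P-contract (filter (λ y → atom? L y ×-dec ¬? (_≤?_ L y H)) (elems L)))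

-- Read coefficientwise, P(W) = Σ_A μ(𝟎,A) z^(f 𝟏 - f A), and the terms with A ≤ H make up
-- z^(f 𝟏 - f H) P(W|_H). For A ≰ H, Weisner's theorem Σ_{x ∧ H = 𝟎} μ(x,A) = 0 applies, and by
-- modularity the x with x ∧ H = 𝟎 are 𝟎 and the atoms not below the coatom H. Hence
-- μ(𝟎,A) = - Σ_{y atom, y ≰ H} μ(y,A), and summing over A produces the contractions P(W/y).
-- Weisner's theorem needs both μ ⊛ ζ = δ, the defining recursion of μ, and ζ ⊛ μ = δ, which holds
-- because a unitriangular one-sided inverse is two-sided. If H is not a flat then f H = f 𝟏.

module Submission where

open import Defs
open import Data.Nat as ℕ using (ℕ; zero; suc; _∸_; z≤n; s≤s)
import Data.Nat.Properties as ℕP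
open import Data.Integer as ℤ using (ℤ; +_; -_; _+_; _-_; _*_)
import Data.Integer.Properties as ℤP
open import Algebra.Properties.Ring ℤP.+-*-ring using (x[y-z]≈xy-xz)
open import Data.Integer.Tactic.RingSolver using (solve-∀)
open import Data.List using (List; []; _∷_; length; map; filter; foldr)
open import Data.List.Properties using (filter-notAll)
open import Data.List.Membership.Propositional using (_∈_)
open import Data.List.Membership.Propositional.Properties using (∈-filter⁻)
open import Data.List.Relation.Unary.Any as Any using (here; there)
open import Data.List.Relation.Unary.All as All using ()
open import Data.List.Relation.Unary.Unique.Propositional using (Unique)
open import Data.List.Relation.Unary.AllPairs using (_∷_)
open import Data.Empty using (⊥-elim)
open import Data.Product using (_×_; _,_; proj₁; proj₂)
open import Relation.Binary.PropositionalEquality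
  using (_≡_; _≢_; refl; sym; trans; cong; cong₂; subst; module ≡-Reasoning)
open import Relation.Binary.Lattice.Structures using (IsBoundedLattice)
open import Relation.Binary.Lattice.Bundles using (BoundedLattice)
import Relation.Binary.Lattice.Properties.MeetSemilattice as MeetSemilatticeProperties
import Relation.Binary.Lattice.Properties.BoundedLattice as BoundedLatticeProperties
import Relation.Binary.Lattice.Properties.BoundedMeetSemilattice as BoundedMeetSemilatticeProperties
import Relation.Binary.Lattice.Properties.BoundedJoinSemilattice as BoundedJoinSemilatticeProperties
open import Level using (0ℓ)
open import Function.Base using (_∘_)
open import Function.Bundles using (_⇔_; mk⇔; Equivalence)
open import Relation.Nullary using (¬_; Dec; yes; no)
open import Relation.Nullary.Decidable using (¬?; _×-dec_)
open import Relation.Unary as U using (Pred; _⊆_)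

[_]·_ : ∀ {p} {P : Set p} → Dec P → ℤ → ℤ
[ yes _ ]· v = v
[ no _ ]· _ = + 0

infixr 8 [_]·_

module _ {p q} {P : Set p} {Q : Set q} where

  []·-cong : P ⇔ Q → (d : Dec P) (e : Dec Q) (v : ℤ) → [ d ]· v ≡ [ e ]· v
  []·-cong _ (yes _) (yes _) _ = refl
  []·-cong P⇔Q (yes p) (no ¬q) _ = ⊥-elim (¬q (Equivalence.to P⇔Q p))
  []·-cong P⇔Q (no ¬p) (yes q) _ = ⊥-elim (¬p (Equivalence.from P⇔Q q))
  []·-cong _ (no _) (no _) _ = refl

  []·-×-dec : (d : Dec P) (e : Dec Q) (v : ℤ) → [ d ×-dec e ]· v ≡ [ d ]· [ e ]· v
  []·-×-dec (yes _) (yes _) _ = refl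
  []·-×-dec (yes _) (no _) _ = refl
  []·-×-dec (no _) _ _ = refl

  []·-comm : (d : Dec P) (e : Dec Q) (v : ℤ) → [ d ]· [ e ]· v ≡ [ e ]· [ d ]· v
  []·-comm (yes _) _ _ = refl
  []·-comm (no _) (yes _) _ = refl
  []·-comm (no _) (no _) _ = refl

module _ {p} {P : Set p} where

  []·-yes : P → (d : Dec P) (v : ℤ) → [ d ]· v ≡ v
  []·-yes _ (yes _) _ = refl
  []·-yes p (no ¬p) _ = ⊥-elim (¬p p)

  []·-no : ¬ P → (d : Dec P) (v : ℤ) → [ d ]· v ≡ + 0
  []·-no ¬p (yes p) _ = ⊥-elim (¬p p)
  []·-no _ (no _) _ = refl

  []·-0 : (d : Dec P) → [ d ]· + 0 ≡ + 0
  []·-0 (yes _) = refl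
  []·-0 (no _) = refl

  []·1-* : (d : Dec P) (v : ℤ) → [ d ]· + 1 * v ≡ [ d ]· v
  []·1-* (yes _) v = ℤP.*-identityˡ v
  []·1-* (no _) v = ℤP.*-zeroˡ v

  *-[]·1 : (d : Dec P) (v : ℤ) → v * [ d ]· + 1 ≡ [ d ]· v
  *-[]·1 (yes _) v = ℤP.*-identityʳ v
  *-[]·1 (no _) v = ℤP.*-zeroʳ v

  []·-distrib-minus : (d : Dec P) (u v : ℤ) → [ d ]· (u - v) ≡ [ d ]· u - [ d ]· v
  []·-distrib-minus (yes _) _ _ = refl
  []·-distrib-minus (no _) _ _ = refl

-- Written via map so that it unfolds to the sums in charPoly.
∑ : ∀ {A : Set} → List A → (A → ℤ) → ℤ
∑ xs g = foldr _+_ (+ 0) (map g xs)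

infix 5 ∑
syntax ∑ xs (λ x → e) = ∑[ x ∈ xs ] e

module _ {A : Set} where

  ∑-cong-∈ : ∀ xs {g h : A → ℤ} → (∀ x → x ∈ xs → g x ≡ h x) → ∑ xs g ≡ ∑ xs h
  ∑-cong-∈ [] _ = refl
  ∑-cong-∈ (x ∷ xs) g≗h = cong₂ _+_ (g≗h x (here refl)) (∑-cong-∈ xs (λ y y∈ → g≗h y (there y∈)))

  ∑-cong : ∀ xs {g h : A → ℤ} → (∀ x → g x ≡ h x) → ∑ xs g ≡ ∑ xs h
  ∑-cong xs g≗h = ∑-cong-∈ xs (λ x _ → g≗h x)

  ∑-0 : (xs : List A) → ∑[ x ∈ xs ] + 0 ≡ + 0
  ∑-0 [] = refl
  ∑-0 (_ ∷ xs) = trans (ℤP.+-identityˡ _) (∑-0 xs)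

  ∑-zero : (xs : List A) {g : A → ℤ} → (∀ x → x ∈ xs → g x ≡ + 0) → ∑ xs g ≡ + 0
  ∑-zero xs g≗0 = trans (∑-cong-∈ xs g≗0) (∑-0 xs)

  ∑-+ : ∀ xs (g h : A → ℤ) → ∑[ x ∈ xs ] (g x + h x) ≡ ∑ xs g + ∑ xs h
  ∑-+ [] _ _ = refl
  ∑-+ (x ∷ xs) g h rewrite ∑-+ xs g h = interchange (g x) (h x) (∑ xs g) (∑ xs h)
    where
    interchange : ∀ a b c d → (a + b) + (c + d) ≡ (a + c) + (b + d)
    interchange = solve-∀

  ∑-neg : ∀ xs (g : A → ℤ) → ∑[ x ∈ xs ] - g x ≡ - ∑ xs g
  ∑-neg [] _ = refl
  ∑-neg (x ∷ xs) g rewrite ∑-neg xs g = sym (ℤP.neg-distrib-+ (g x) (∑ xs g))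

  ∑-minus : ∀ xs (g h : A → ℤ) → ∑[ x ∈ xs ] (g x - h x) ≡ ∑ xs g - ∑ xs h
  ∑-minus xs g h = trans (∑-+ xs g (λ x → - h x)) (cong (_+_ (∑ xs g)) (∑-neg xs h))

  *-distribˡ-∑ : ∀ xs c (g : A → ℤ) → c * ∑ xs g ≡ ∑[ x ∈ xs ] (c * g x)
  *-distribˡ-∑ [] c _ = ℤP.*-zeroʳ c
  *-distribˡ-∑ (x ∷ xs) c g rewrite sym (*-distribˡ-∑ xs c g) = ℤP.*-distribˡ-+ c (g x) (∑ xs g)

  *-distribʳ-∑ : ∀ xs c (g : A → ℤ) → ∑ xs g * c ≡ ∑[ x ∈ xs ] (g x * c)
  *-distribʳ-∑ [] _ _ = refl
  *-distribʳ-∑ (x ∷ xs) c g rewrite sym (*-distribʳ-∑ xs c g) = ℤP.*-distribʳ-+ c (g x) (∑ xs g)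

  []·-distrib-∑ : ∀ {p} {P : Set p} (d : Dec P) xs (g : A → ℤ) → [ d ]· ∑ xs g ≡ ∑[ x ∈ xs ] [ d ]· g x
  []·-distrib-∑ (yes _) _ _ = refl
  []·-distrib-∑ (no _) xs _ = sym (∑-0 xs)

  ∑-filter : ∀ {p} {P : Pred A p} (P? : U.Decidable P) xs (g : A → ℤ) →
             ∑ (filter P? xs) g ≡ ∑[ x ∈ xs ] [ P? x ]· g x
  ∑-filter P? [] _ = refl
  ∑-filter P? (x ∷ xs) g with P? x
  ... | yes _ = cong (_+_ (g x)) (∑-filter P? xs g)
  ... | no _ = trans (∑-filter P? xs g) (sym (ℤP.+-identityˡ _))

  ∑-unique-≟ : (_≟_ : (a b : A) → Dec (a ≡ b)) → ∀ {xs} → Unique xs → ∀ {a} → a ∈ xs →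
               (g : A → ℤ) → ∑[ x ∈ xs ] [ a ≟ x ]· g x ≡ g a
  ∑-unique-≟ _≟_ {x ∷ xs} (x∉xs ∷ _) (here refl) g with x ≟ x
  ... | no x≢x = ⊥-elim (x≢x refl)
  ... | yes _ = trans (cong (_+_ (g x)) (∑-zero xs others)) (ℤP.+-identityʳ (g x))
    where
    others : ∀ y → y ∈ xs → [ x ≟ y ]· g y ≡ + 0
    others y y∈xs = []·-no (λ { refl → All.lookup x∉xs y∈xs refl }) (x ≟ y) (g y)
  ∑-unique-≟ _≟_ {x ∷ xs} (x∉xs ∷ xs-unique) {a} (there a∈xs) g =
    trans (cong (λ s → s + _) ([]·-no (λ { refl → All.lookup x∉xs a∈xs refl }) (a ≟ x) (g x)))
          (trans (ℤP.+-identityˡ _) (∑-unique-≟ _≟_ xs-unique a∈xs g))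

∑-swap : ∀ {A B : Set} (xs : List A) (ys : List B) (h : A → B → ℤ) →
         ∑[ x ∈ xs ] ∑[ y ∈ ys ] h x y ≡ ∑[ y ∈ ys ] ∑[ x ∈ xs ] h x y
∑-swap [] ys _ = sym (∑-0 ys)
∑-swap (x ∷ xs) ys h rewrite ∑-swap xs ys h = sym (∑-+ ys (h x) (λ y → ∑[ x ∈ xs ] h x y))

module _ {A : Set} {p q} {P : Pred A p} {Q : Pred A q} (P? : U.Decidable P) (Q? : U.Decidable Q)
         (P⊆Q : P ⊆ Q) where

  length-filter-mono : ∀ xs → length (filter P? xs) ℕ.≤ length (filter Q? xs)
  length-filter-mono [] = z≤n
  length-filter-mono (x ∷ xs) with P? x | Q? x
  ... | yes _ | yes _ = s≤s (length-filter-mono xs)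
  ... | yes px | no ¬qx = ⊥-elim (¬qx (P⊆Q px))
  ... | no _ | yes _ = ℕP.m≤n⇒m≤1+n (length-filter-mono xs)
  ... | no _ | no _ = length-filter-mono xs

  length-filter-⊂ : ∀ xs {a} → a ∈ xs → Q a → ¬ P a → length (filter P? xs) ℕ.< length (filter Q? xs)
  length-filter-⊂ (x ∷ xs) (here refl) qx ¬px with P? x | Q? x
  ... | yes px | _ = ⊥-elim (¬px px)
  ... | no _ | yes _ = s≤s (length-filter-mono xs)
  ... | no _ | no ¬qx = ⊥-elim (¬qx qx)
  length-filter-⊂ (x ∷ xs) (there a∈xs) qa ¬pa with P? x | Q? x
  ... | yes _ | yes _ = s≤s (length-filter-⊂ xs a∈xs qa ¬pa)
  ... | yes px | no ¬qx = ⊥-elim (¬qx (P⊆Q px))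
  ... | no _ | yes _ = ℕP.m≤n⇒m≤1+n (length-filter-⊂ xs a∈xs qa ¬pa)
  ... | no _ | no _ = length-filter-⊂ xs a∈xs qa ¬pa

∸-split : ∀ {a b c} → a ℕ.≤ b → b ℕ.≤ c → c ∸ a ≡ (c ∸ b) ℕ.+ (b ∸ a)
∸-split {a} {b} {c} a≤b b≤c = trans (cong (_∸ a) (sym (ℕP.m∸n+n≡m b≤c))) (ℕP.+-∸-assoc (c ∸ b) a≤b)

∸-≡-shift : ∀ {a b c k} → a ℕ.≤ b → b ℕ.≤ c → c ∸ b ℕ.≤ k → (b ∸ a ≡ k ∸ (c ∸ b)) ⇔ (c ∸ a ≡ k)
∸-≡-shift {a} {b} {c} {k} a≤b b≤c c∸b≤k = mk⇔ to from
  where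
  to : b ∸ a ≡ k ∸ (c ∸ b) → c ∸ a ≡ k
  to b∸a≡k∸[c∸b] = trans (∸-split a≤b b≤c) (trans (cong ((c ∸ b) ℕ.+_) b∸a≡k∸[c∸b]) (ℕP.m+[n∸m]≡n c∸b≤k))
  from : c ∸ a ≡ k → b ∸ a ≡ k ∸ (c ∸ b)
  from c∸a≡k = trans (sym (ℕP.m+n∸m≡n (c ∸ b) (b ∸ a)))
                     (cong (_∸ (c ∸ b)) (trans (sym (∸-split a≤b b≤c)) c∸a≡k))

ΣP-coeff : ∀ {A : Set} (g : A → Poly) xs k → ΣP (map g xs) k ≡ ∑[ x ∈ xs ] g x k
ΣP-coeff g [] k = refl
ΣP-coeff g (x ∷ xs) k = cong (_+_ (g x k)) (ΣP-coeff g xs k)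

z^0-identity : ∀ p → (z^ 0 · p) ≈P p
z^0-identity p k with k ℕ.<? 0
... | no _ = refl

module IncidenceAlgebra (L : FiniteModularComplementedLattice) where

  open FiniteModularComplementedLattice L using ()
    renaming (Carrier to C; _≤_ to _⊑_; _<_ to _⊏_; _≤?_ to _⊑?_; _<?_ to _⊏?_; _≟_ to _≟ᴸ_;
              _∧_ to _⊓_; _∨_ to _⊔_; 𝟎 to 𝟘; 𝟏 to 𝟙)
  open IsBoundedLattice (isBoundedLattice L)
    using (antisym; minimum; maximum; x∧y≤x; x∧y≤y; ∧-greatest; x≤x∨y; y≤x∨y)
    renaming (refl to ⊑-refl; trans to ⊑-trans)

  boundedLattice : BoundedLattice 0ℓ 0ℓ 0ℓ
  boundedLattice = record
    { Carrier = C ; _≈_ = _≡_ ; _≤_ = _⊑_ ; _∨_ = _⊔_ ; _∧_ = _⊓_ ; ⊤ = 𝟙 ; ⊥ = 𝟘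
    ; isBoundedLattice = isBoundedLattice L }

  open BoundedLattice boundedLattice using (meetSemilattice; boundedMeetSemilattice; boundedJoinSemilattice)
  open BoundedLatticeProperties boundedLattice using (∧-zeroˡ)
  open MeetSemilatticeProperties meetSemilattice using (∧-comm)
  open BoundedMeetSemilatticeProperties boundedMeetSemilattice using () renaming (identityˡ to ∧-identityˡ)
  open BoundedJoinSemilatticeProperties boundedJoinSemilattice using () renaming (identityʳ to ∨-identityʳ)

  ⊏-irrefl : ∀ {x} → ¬ x ⊏ x
  ⊏-irrefl (_ , x≢x) = x≢x refl

  ⊑-⊏-trans : ∀ {x y z} → x ⊑ y → y ⊏ z → x ⊏ z
  ⊑-⊏-trans x⊑y (y⊑z , y≢z) = ⊑-trans x⊑y y⊑z , λ { refl → y≢z (antisym y⊑z x⊑y) }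

  ⊏-⊑-trans : ∀ {x y z} → x ⊏ y → y ⊑ z → x ⊏ z
  ⊏-⊑-trans (x⊑y , x≢y) y⊑z = ⊑-trans x⊑y y⊑z , λ { refl → x≢y (antisym x⊑y y⊑z) }

  ∈Ico? : ∀ x y z → Dec (x ⊑ z × z ⊏ y)
  ∈Ico? x y z = (x ⊑? z) ×-dec (z ⊏? y)

  Ico : C → C → List C
  Ico x y = filter (∈Ico? x y) (elems L)

  ∈-Ico⁻ : ∀ {x y z} → z ∈ Ico x y → x ⊑ z × z ⊏ y
  ∈-Ico⁻ {x} {y} z∈ = proj₂ (∈-filter⁻ (∈Ico? x y) {xs = elems L} z∈)

  ∑-Ico-⊀ : ∀ {x y} (g : C → ℤ) → ¬ x ⊏ y → ∑ (Ico x y) g ≡ + 0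
  ∑-Ico-⊀ g x⊀y = ∑-zero _ λ _ z∈ → let (x⊑z , z⊏y) = ∈-Ico⁻ z∈ in ⊥-elim (x⊀y (⊑-⊏-trans x⊑z z⊏y))

  length-Ico-< : ∀ {x y z} → x ⊑ z → z ⊏ y → length (Ico x z) ℕ.< length (Ico x y)
  length-Ico-< {x} {y} {z} x⊑z z⊏y =
    length-filter-⊂ (∈Ico? x z) (∈Ico? x y)
      (λ (x⊑w , w⊏z) → x⊑w , ⊏-⊑-trans w⊏z (proj₁ z⊏y))
      (elems L) (complete L z) (x⊑z , z⊏y) (λ (_ , z⊏z) → ⊏-irrefl z⊏z)

  length-Ico<size : ∀ x y → length (Ico x y) ℕ.< length (elems L)
  length-Ico<size x y =
    filter-notAll (∈Ico? x y) (elems L)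
      (Any.map (λ { refl (_ , y⊏y) → ⊏-irrefl y⊏y }) (complete L y))

  möbiusFuel-stable : ∀ {k k'} x y → length (Ico x y) ℕ.< k → length (Ico x y) ℕ.< k' →
                      möbiusFuel L k x y ≡ möbiusFuel L k' x y
  möbiusFuel-stable {suc k} {suc k'} x y (s≤s ≤k) (s≤s ≤k') with x ≟ᴸ y
  ... | yes _ = refl
  ... | no _ with x ⊑? y
  ...   | no _ = refl
  ...   | yes _ = cong -_ (∑-cong-∈ (Ico x y) λ z z∈ →
            let (x⊑z , z⊏y) = ∈-Ico⁻ z∈ ; shorter = length-Ico-< x⊑z z⊏y
            in möbiusFuel-stable x z (ℕP.<-≤-trans shorter ≤k) (ℕP.<-≤-trans shorter ≤k'))

  möbiusFuel-unfold : ∀ {k x y} → length (Ico x y) ℕ.< k → x ⊑ y → x ≢ y →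
                      möbiusFuel L k x y ≡ - (∑[ z ∈ Ico x y ] möbiusFuel L k x z)
  möbiusFuel-unfold {suc k} {x} {y} (s≤s ≤k) x⊑y x≢y with x ≟ᴸ y
  ... | yes x≡y = ⊥-elim (x≢y x≡y)
  ... | no _ with x ⊑? y
  ...   | no x⋢y = ⊥-elim (x⋢y x⊑y)
  ...   | yes _ = cong -_ (∑-cong-∈ (Ico x y) λ z z∈ →
            let (x⊑z , z⊏y) = ∈-Ico⁻ z∈ ; shorter = length-Ico-< x⊑z z⊏y
            in möbiusFuel-stable x z (ℕP.<-≤-trans shorter ≤k) (ℕP.m≤n⇒m≤1+n (ℕP.<-≤-trans shorter ≤k)))

  μ-unfold : ∀ {x y} → x ⊑ y → x ≢ y → μ L x y ≡ - (∑[ z ∈ Ico x y ] μ L x z)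
  μ-unfold {x} {y} = möbiusFuel-unfold (length-Ico<size x y)

  μ-refl : ∀ x → μ L x x ≡ + 1
  μ-refl x = fuel-refl (length (elems L))
    where
    fuel-refl : ∀ k → möbiusFuel L k x x ≡ + 1
    fuel-refl k with x ≟ᴸ x
    ... | yes _ = refl
    ... | no x≢x = ⊥-elim (x≢x refl)

  μ-⋢ : ∀ {x y} → ¬ x ⊑ y → μ L x y ≡ + 0
  μ-⋢ {x} {y} x⋢y = fuel-⋢ (length (elems L))
    where
    fuel-⋢ : ∀ k → möbiusFuel L k x y ≡ + 0
    fuel-⋢ k with x ≟ᴸ y
    ... | yes refl = ⊥-elim (x⋢y ⊑-refl)
    fuel-⋢ zero | no _ = refl
    fuel-⋢ (suc k) | no _ with x ⊑? y
    ...   | yes x⊑y = ⊥-elim (x⋢y x⊑y)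
    ...   | no _ = refl

  μ-masked : ∀ x y → [ x ⊑? y ]· μ L x y ≡ μ L x y
  μ-masked x y with x ⊑? y
  ... | yes _ = refl
  ... | no x⋢y = sym (μ-⋢ x⋢y)

  ζ δ : C → C → ℤ
  ζ x y = [ x ⊑? y ]· + 1
  δ x y = [ x ≟ᴸ y ]· + 1

  infixl 7 _⊛_
  _⊛_ : (C → C → ℤ) → (C → C → ℤ) → C → C → ℤ
  (α ⊛ β) x y = ∑[ v ∈ elems L ] α x v * β v y

  ∑-[≟] : ∀ a (g : C → ℤ) → ∑[ x ∈ elems L ] [ a ≟ᴸ x ]· g x ≡ g a
  ∑-[≟] a = ∑-unique-≟ _≟ᴸ_ (unique L) (complete L a)

  ⊛-identityˡ : ∀ α x y → (δ ⊛ α) x y ≡ α x y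
  ⊛-identityˡ α x y = trans (∑-cong (elems L) λ v → []·1-* (x ≟ᴸ v) (α v y)) (∑-[≟] x (λ v → α v y))

  ⊛-identityʳ : ∀ α x y → (α ⊛ δ) x y ≡ α x y
  ⊛-identityʳ α x y = trans (∑-cong (elems L) diagonal) (∑-[≟] y (α x))
    where
    diagonal : ∀ v → α x v * δ v y ≡ [ y ≟ᴸ v ]· α x v
    diagonal v = trans (*-[]·1 (v ≟ᴸ y) (α x v)) ([]·-cong (mk⇔ sym sym) (v ≟ᴸ y) (y ≟ᴸ v) (α x v))

  ⊛-assoc : ∀ α β γ x y → ((α ⊛ β) ⊛ γ) x y ≡ (α ⊛ (β ⊛ γ)) x y
  ⊛-assoc α β γ x y = begin
    ∑[ v ∈ elems L ] (∑[ u ∈ elems L ] α x u * β u v) * γ v y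
      ≡⟨ ∑-cong (elems L) (λ v → *-distribʳ-∑ (elems L) (γ v y) _) ⟩
    ∑[ v ∈ elems L ] ∑[ u ∈ elems L ] α x u * β u v * γ v y
      ≡⟨ ∑-swap (elems L) (elems L) _ ⟩
    ∑[ u ∈ elems L ] ∑[ v ∈ elems L ] α x u * β u v * γ v y
      ≡⟨ ∑-cong (elems L) (λ u → ∑-cong (elems L) (λ v → ℤP.*-assoc (α x u) (β u v) (γ v y))) ⟩
    ∑[ u ∈ elems L ] ∑[ v ∈ elems L ] α x u * (β u v * γ v y)
      ≡⟨ ∑-cong (elems L) (λ u → sym (*-distribˡ-∑ (elems L) (α x u) _)) ⟩
    ∑[ u ∈ elems L ] α x u * (∑[ v ∈ elems L ] β u v * γ v y) ∎
    where open ≡-Reasoning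

  μ⊛ζ≡∑Ico+μ : ∀ x y → (μ L ⊛ ζ) x y ≡ (∑[ z ∈ Ico x y ] μ L x z) + μ L x y
  μ⊛ζ≡∑Ico+μ x y = begin
    ∑[ v ∈ elems L ] μ L x v * ζ v y
      ≡⟨ ∑-cong (elems L) (λ v → split v (x ⊑? v) (v ≟ᴸ y)) ⟩
    ∑[ v ∈ elems L ] ([ ∈Ico? x y v ]· μ L x v + [ y ≟ᴸ v ]· μ L x v)
      ≡⟨ ∑-+ (elems L) _ _ ⟩
    (∑[ v ∈ elems L ] [ ∈Ico? x y v ]· μ L x v) + (∑[ v ∈ elems L ] [ y ≟ᴸ v ]· μ L x v)
      ≡⟨ cong₂ _+_ (sym (∑-filter (∈Ico? x y) (elems L) (μ L x))) (∑-[≟] y (μ L x)) ⟩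
    (∑[ z ∈ Ico x y ] μ L x z) + μ L x y ∎
    where
    open ≡-Reasoning
    split : ∀ v → Dec (x ⊑ v) → Dec (v ≡ y) →
            μ L x v * ζ v y ≡ [ ∈Ico? x y v ]· μ L x v + [ y ≟ᴸ v ]· μ L x v
    split v (no x⋢v) _ rewrite μ-⋢ x⋢v =
      trans (ℤP.*-zeroˡ (ζ v y)) (sym (cong₂ _+_ ([]·-0 (∈Ico? x y v)) ([]·-0 (y ≟ᴸ v))))
    split v (yes x⊑v) (yes v≡y) = begin
      μ L x v * ζ v y
        ≡⟨ *-[]·1 (v ⊑? y) (μ L x v) ⟩
      [ v ⊑? y ]· μ L x v
        ≡⟨ []·-yes (subst (v ⊑_) v≡y ⊑-refl) (v ⊑? y) _ ⟩
      μ L x v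
        ≡⟨ sym (ℤP.+-identityˡ (μ L x v)) ⟩
      + 0 + μ L x v
        ≡⟨ sym (cong₂ _+_ ([]·-no (λ (_ , _ , v≢y) → v≢y v≡y) (∈Ico? x y v) _)
                          ([]·-yes (sym v≡y) (y ≟ᴸ v) _)) ⟩
      [ ∈Ico? x y v ]· μ L x v + [ y ≟ᴸ v ]· μ L x v ∎
    split v (yes x⊑v) (no v≢y) = begin
      μ L x v * ζ v y
        ≡⟨ *-[]·1 (v ⊑? y) (μ L x v) ⟩
      [ v ⊑? y ]· μ L x v
        ≡⟨ []·-cong (mk⇔ (λ v⊑y → x⊑v , v⊑y , v≢y) (λ (_ , v⊏y) → proj₁ v⊏y)) (v ⊑? y) (∈Ico? x y v) _ ⟩
      [ ∈Ico? x y v ]· μ L x v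
        ≡⟨ sym (ℤP.+-identityʳ _) ⟩
      [ ∈Ico? x y v ]· μ L x v + + 0
        ≡⟨ cong (_+_ ([ ∈Ico? x y v ]· μ L x v)) (sym ([]·-no (λ y≡v → v≢y (sym y≡v)) (y ≟ᴸ v) _)) ⟩
      [ ∈Ico? x y v ]· μ L x v + [ y ≟ᴸ v ]· μ L x v ∎

  μ⊛ζ≡δ : ∀ x y → (μ L ⊛ ζ) x y ≡ δ x y
  μ⊛ζ≡δ x y with x ≟ᴸ y | x ⊑? y
  ... | yes refl | _ = trans (μ⊛ζ≡∑Ico+μ x x) (cong₂ _+_ (∑-Ico-⊀ (μ L x) ⊏-irrefl) (μ-refl x))
  ... | no _ | no x⋢y = trans (μ⊛ζ≡∑Ico+μ x y) (cong₂ _+_ (∑-Ico-⊀ (μ L x) (x⋢y ∘ proj₁)) (μ-⋢ x⋢y))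
  ... | no x≢y | yes x⊑y = begin
    (μ L ⊛ ζ) x y                   ≡⟨ μ⊛ζ≡∑Ico+μ x y ⟩
    ∑Ico + μ L x y                  ≡⟨ cong (_+_ ∑Ico) (μ-unfold x⊑y x≢y) ⟩
    ∑Ico - ∑Ico                     ≡⟨ ℤP.+-inverseʳ ∑Ico ⟩
    + 0 ∎
    where
    open ≡-Reasoning
    ∑Ico : ℤ
    ∑Ico = ∑[ z ∈ Ico x y ] μ L x z

  μ-cancelˡ : (e : C → ℤ) → (∀ w → ∑[ v ∈ elems L ] μ L w v * e v ≡ + 0) → ∀ w → e w ≡ + 0
  μ-cancelˡ e μe≡0 w = cancel (suc (#above w)) w ℕP.≤-refl
    where
    #above : C → ℕ
    #above w = length (filter (w ⊏?_) (elems L))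

    #above-< : ∀ {w v} → w ⊏ v → #above v ℕ.< #above w
    #above-< {w} {v} w⊏v = length-filter-⊂ (v ⊏?_) (w ⊏?_) (λ v⊏u → ⊏-⊑-trans w⊏v (proj₁ v⊏u))
                             (elems L) (complete L v) w⊏v ⊏-irrefl

    -- μ is unitriangular: e w is recovered from the w-th equation once e vanishes strictly above w.
    cancel : ∀ k w → #above w ℕ.< k → e w ≡ + 0
    cancel (suc k) w (s≤s ≤k) = begin
      e w                                   ≡⟨ sym (∑-[≟] w e) ⟩
      ∑[ v ∈ elems L ] [ w ≟ᴸ v ]· e v      ≡⟨ ∑-cong (elems L) (λ v → sym (diagonal v (w ≟ᴸ v) (w ⊑? v))) ⟩
      ∑[ v ∈ elems L ] μ L w v * e v        ≡⟨ μe≡0 w ⟩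
      + 0 ∎
      where
      open ≡-Reasoning
      diagonal : ∀ v (w≟v : Dec (w ≡ v)) → Dec (w ⊑ v) → μ L w v * e v ≡ [ w≟v ]· e v
      diagonal v (yes refl) _ rewrite μ-refl w = ℤP.*-identityˡ (e w)
      diagonal v (no _) (no w⋢v) rewrite μ-⋢ w⋢v = ℤP.*-zeroˡ (e v)
      diagonal v (no w≢v) (yes w⊑v)
        rewrite cancel k v (ℕP.<-≤-trans (#above-< (w⊑v , w≢v)) ≤k) = ℤP.*-zeroʳ (μ L w v)

  ζ⊛μ≡δ : ∀ x y → (ζ ⊛ μ L) x y ≡ δ x y
  ζ⊛μ≡δ x y = ℤP.i-j≡0⇒i≡j _ _ (μ-cancelˡ (λ v → (ζ ⊛ μ L) v y - δ v y) μ⊛[ζ⊛μ-δ]≡0 x)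
    where
    μ⊛[ζ⊛μ-δ]≡0 : ∀ w → ∑[ v ∈ elems L ] μ L w v * ((ζ ⊛ μ L) v y - δ v y) ≡ + 0
    μ⊛[ζ⊛μ-δ]≡0 w = begin
      ∑[ v ∈ elems L ] μ L w v * ((ζ ⊛ μ L) v y - δ v y)
        ≡⟨ ∑-cong (elems L) (λ v → x[y-z]≈xy-xz (μ L w v) _ _) ⟩
      ∑[ v ∈ elems L ] (μ L w v * (ζ ⊛ μ L) v y - μ L w v * δ v y)
        ≡⟨ ∑-minus (elems L) _ _ ⟩
      (μ L ⊛ (ζ ⊛ μ L)) w y - (μ L ⊛ δ) w y
        ≡⟨ cong₂ _-_ (sym (⊛-assoc (μ L) ζ (μ L) w y)) (⊛-identityʳ (μ L) w y) ⟩
      ((μ L ⊛ ζ) ⊛ μ L) w y - μ L w y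
        ≡⟨ cong (_- μ L w y) (∑-cong (elems L) λ v → cong (_* μ L v y) (μ⊛ζ≡δ w v)) ⟩
      (δ ⊛ μ L) w y - μ L w y
        ≡⟨ cong (_- μ L w y) (⊛-identityˡ (μ L) w y) ⟩
      μ L w y - μ L w y
        ≡⟨ ℤP.+-inverseʳ (μ L w y) ⟩
      + 0 ∎
      where open ≡-Reasoning

  ζ-⊓ : ∀ w x y → ζ w (x ⊓ y) ≡ ζ w x * ζ w y
  ζ-⊓ w x y = begin
    [ w ⊑? (x ⊓ y) ]· + 1              ≡⟨ []·-cong ⊑-⊓⇔ (w ⊑? (x ⊓ y)) ((w ⊑? x) ×-dec (w ⊑? y)) (+ 1) ⟩
    [ (w ⊑? x) ×-dec (w ⊑? y) ]· + 1   ≡⟨ []·-×-dec (w ⊑? x) (w ⊑? y) (+ 1) ⟩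
    [ w ⊑? x ]· [ w ⊑? y ]· + 1        ≡⟨ sym ([]·1-* (w ⊑? x) (ζ w y)) ⟩
    ζ w x * ζ w y ∎
    where
    open ≡-Reasoning
    ⊑-⊓⇔ : w ⊑ (x ⊓ y) ⇔ (w ⊑ x × w ⊑ y)
    ⊑-⊓⇔ = mk⇔ (λ w⊑x⊓y → ⊑-trans w⊑x⊓y (x∧y≤x x y) , ⊑-trans w⊑x⊓y (x∧y≤y x y))
               (λ (w⊑x , w⊑y) → ∧-greatest w⊑x w⊑y)

  weisner : ∀ b {H A} → ¬ A ⊑ H → ∑[ x ∈ elems L ] δ b (x ⊓ H) * μ L x A ≡ + 0
  weisner b {H} {A} A⋢H = begin
    ∑[ x ∈ elems L ] δ b (x ⊓ H) * μ L x A
      ≡⟨ ∑-cong (elems L) (λ x → cong (_* μ L x A) (sym (μ⊛ζ≡δ b (x ⊓ H)))) ⟩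
    ∑[ x ∈ elems L ] (∑[ w ∈ elems L ] μ L b w * ζ w (x ⊓ H)) * μ L x A
      ≡⟨ ∑-cong (elems L) (λ x → *-distribʳ-∑ (elems L) (μ L x A) _) ⟩
    ∑[ x ∈ elems L ] ∑[ w ∈ elems L ] μ L b w * ζ w (x ⊓ H) * μ L x A
      ≡⟨ ∑-swap (elems L) (elems L) _ ⟩
    ∑[ w ∈ elems L ] ∑[ x ∈ elems L ] μ L b w * ζ w (x ⊓ H) * μ L x A
      ≡⟨ ∑-cong (elems L) (λ w → ∑-cong (elems L) (regroup w)) ⟩
    ∑[ w ∈ elems L ] ∑[ x ∈ elems L ] (μ L b w * ζ w H) * (ζ w x * μ L x A)
      ≡⟨ ∑-cong (elems L) (λ w → sym (*-distribˡ-∑ (elems L) (μ L b w * ζ w H) _)) ⟩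
    ∑[ w ∈ elems L ] (μ L b w * ζ w H) * (ζ ⊛ μ L) w A
      ≡⟨ ∑-cong (elems L) (λ w → cong (μ L b w * ζ w H *_) (ζ⊛μ≡δ w A)) ⟩
    ((λ b w → μ L b w * ζ w H) ⊛ δ) b A
      ≡⟨ ⊛-identityʳ (λ b w → μ L b w * ζ w H) b A ⟩
    μ L b A * ζ A H
      ≡⟨ cong (μ L b A *_) ([]·-no A⋢H (A ⊑? H) (+ 1)) ⟩
    μ L b A * + 0
      ≡⟨ ℤP.*-zeroʳ (μ L b A) ⟩
    + 0 ∎
    where
    open ≡-Reasoning
    regroup : ∀ w x → μ L b w * ζ w (x ⊓ H) * μ L x A ≡ (μ L b w * ζ w H) * (ζ w x * μ L x A)
    regroup w x rewrite ζ-⊓ w x H = rearrange (μ L b w) (ζ w x) (ζ w H) (μ L x A)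
      where
      rearrange : ∀ a b c d → a * (b * c) * d ≡ (a * c) * (b * d)
      rearrange = solve-∀

  atomNotBelow? : ∀ H y → Dec (IsAtom L y × ¬ y ⊑ H)
  atomNotBelow? H y = atom? L y ×-dec ¬? (y ⊑? H)

  ∑μ-atomsNotBelow : C → C → ℤ
  ∑μ-atomsNotBelow H A = ∑[ y ∈ elems L ] [ atomNotBelow? H y ]· μ L y A

  atom⊓≡𝟘 : ∀ {H y} → IsAtom L y → ¬ y ⊑ H → 𝟘 ≡ y ⊓ H
  atom⊓≡𝟘 {H} {y} (_ , nothing-below) y⋢H with 𝟘 ≟ᴸ (y ⊓ H)
  ... | yes 𝟘≡y⊓H = 𝟘≡y⊓H
  ... | no 𝟘≢y⊓H = ⊥-elim (nothing-below (y ⊓ H) ((minimum (y ⊓ H) , 𝟘≢y⊓H) , (x∧y≤x y H , y⊓H≢y)))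
    where
    y⊓H≢y : y ⊓ H ≢ y
    y⊓H≢y y⊓H≡y = y⋢H (subst (_⊑ H) y⊓H≡y (x∧y≤y y H))

  -- By modularity, any z strictly between 𝟘 and x satisfies z = (z ⊔ H) ⊓ x = 𝟙 ⊓ x = x.
  ⊓-coatom≡𝟘⇒atom : ∀ {H x} → IsCoatom L H → 𝟘 ≡ x ⊓ H → 𝟘 ≢ x → IsAtom L x × ¬ x ⊑ H
  ⊓-coatom≡𝟘⇒atom {H} {x} (_ , nothing-above) 𝟘≡x⊓H 𝟘≢x = ((minimum x , 𝟘≢x) , nothing-below) , x⋢H
    where
    ⋢H : ∀ {z} → z ⊑ x → 𝟘 ≢ z → ¬ z ⊑ H
    ⋢H z⊑x 𝟘≢z z⊑H = 𝟘≢z (antisym (minimum _) (subst (_ ⊑_) (sym 𝟘≡x⊓H) (∧-greatest z⊑x z⊑H)))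

    x⋢H : ¬ x ⊑ H
    x⋢H = ⋢H ⊑-refl 𝟘≢x

    nothing-below : ∀ z → ¬ ((𝟘 ⊏ z) × (z ⊏ x))
    nothing-below z ((_ , 𝟘≢z) , (z⊑x , z≢x)) = z≢x z≡x
      where
      H⊏z⊔H : H ⊏ (z ⊔ H)
      H⊏z⊔H = y≤x∨y z H , λ H≡z⊔H → ⋢H z⊑x 𝟘≢z (subst (z ⊑_) (sym H≡z⊔H) (x≤x∨y z H))

      z⊔H≡𝟙 : z ⊔ H ≡ 𝟙
      z⊔H≡𝟙 with (z ⊔ H) ≟ᴸ 𝟙
      ... | yes z⊔H≡𝟙 = z⊔H≡𝟙
      ... | no z⊔H≢𝟙 = ⊥-elim (nothing-above (z ⊔ H) (H⊏z⊔H , (maximum _ , z⊔H≢𝟙)))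

      z≡x : z ≡ x
      z≡x = begin
        z             ≡⟨ sym (∨-identityʳ z) ⟩
        z ⊔ 𝟘         ≡⟨ cong (z ⊔_) (trans 𝟘≡x⊓H (∧-comm x H)) ⟩
        z ⊔ (H ⊓ x)   ≡⟨ modular L z H x z⊑x ⟩
        (z ⊔ H) ⊓ x   ≡⟨ cong (_⊓ x) z⊔H≡𝟙 ⟩
        𝟙 ⊓ x         ≡⟨ ∧-identityˡ x ⟩
        x ∎
        where open ≡-Reasoning

  δ𝟘-⊓-coatom : ∀ {H} → IsCoatom L H → ∀ x → δ 𝟘 (x ⊓ H) ≡ δ 𝟘 x + [ atomNotBelow? H x ]· + 1
  δ𝟘-⊓-coatom {H} H-coatom x = by-cases (𝟘 ≟ᴸ x)
    where
    open ≡-Reasoning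
    by-cases : Dec (𝟘 ≡ x) → δ 𝟘 (x ⊓ H) ≡ δ 𝟘 x + [ atomNotBelow? H x ]· + 1
    by-cases (yes 𝟘≡x) = begin
      δ 𝟘 (x ⊓ H)
        ≡⟨ []·-yes (subst (λ x → 𝟘 ≡ x ⊓ H) 𝟘≡x (sym (∧-zeroˡ H))) (𝟘 ≟ᴸ (x ⊓ H)) (+ 1) ⟩
      + 1 + + 0
        ≡⟨ sym (cong₂ _+_ ([]·-yes 𝟘≡x (𝟘 ≟ᴸ x) (+ 1))
                          ([]·-no (λ ((𝟘⊏x , _) , _) → proj₂ 𝟘⊏x 𝟘≡x) (atomNotBelow? H x) (+ 1))) ⟩
      δ 𝟘 x + [ atomNotBelow? H x ]· + 1 ∎
    by-cases (no 𝟘≢x) = begin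
      δ 𝟘 (x ⊓ H)
        ≡⟨ []·-cong (mk⇔ (λ 𝟘≡x⊓H → ⊓-coatom≡𝟘⇒atom H-coatom 𝟘≡x⊓H 𝟘≢x) (λ (atom , x⋢H) → atom⊓≡𝟘 atom x⋢H))
                    (𝟘 ≟ᴸ (x ⊓ H)) (atomNotBelow? H x) (+ 1) ⟩
      [ atomNotBelow? H x ]· + 1
        ≡⟨ sym (ℤP.+-identityˡ _) ⟩
      + 0 + [ atomNotBelow? H x ]· + 1
        ≡⟨ cong (λ d → d + [ atomNotBelow? H x ]· + 1) (sym ([]·-no 𝟘≢x (𝟘 ≟ᴸ x) (+ 1))) ⟩
      δ 𝟘 x + [ atomNotBelow? H x ]· + 1 ∎

  μ𝟘+∑atomsNotBelow≡0 : ∀ {H A} → IsCoatom L H → ¬ A ⊑ H →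
                        μ L 𝟘 A + ∑μ-atomsNotBelow H A ≡ + 0
  μ𝟘+∑atomsNotBelow≡0 {H} {A} H-coatom A⋢H = begin
    μ L 𝟘 A + ∑μ-atomsNotBelow H A
      ≡⟨ cong₂ _+_ (sym (⊛-identityˡ (μ L) 𝟘 A))
                   (∑-cong (elems L) λ y → sym ([]·1-* (atomNotBelow? H y) (μ L y A))) ⟩
    (δ ⊛ μ L) 𝟘 A + (∑[ y ∈ elems L ] [ atomNotBelow? H y ]· + 1 * μ L y A)
      ≡⟨ sym (∑-+ (elems L) _ _) ⟩
    ∑[ x ∈ elems L ] (δ 𝟘 x * μ L x A + [ atomNotBelow? H x ]· + 1 * μ L x A)
      ≡⟨ ∑-cong (elems L) (λ x → sym (split x)) ⟩
    ∑[ x ∈ elems L ] δ 𝟘 (x ⊓ H) * μ L x A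
      ≡⟨ weisner 𝟘 A⋢H ⟩
    + 0 ∎
    where
    open ≡-Reasoning
    split : ∀ x → δ 𝟘 (x ⊓ H) * μ L x A ≡ δ 𝟘 x * μ L x A + [ atomNotBelow? H x ]· + 1 * μ L x A
    split x = trans (cong (_* μ L x A) (δ𝟘-⊓-coatom H-coatom x))
                    (ℤP.*-distribʳ-+ (μ L x A) (δ 𝟘 x) ([ atomNotBelow? H x ]· + 1))

  μ𝟘-coatom : ∀ {H} → IsCoatom L H → ∀ A →
              μ L 𝟘 A ≡ [ A ⊑? H ]· μ L 𝟘 A - ∑μ-atomsNotBelow H A
  μ𝟘-coatom {H} H-coatom A with A ⊑? H
  ... | yes A⊑H = sym (trans (cong (_-_ (μ L 𝟘 A)) (∑-zero (elems L) λ y _ → no-atom-below y))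
                             (ℤP.+-identityʳ (μ L 𝟘 A)))
    where
    no-atom-below : ∀ y → [ atomNotBelow? H y ]· μ L y A ≡ + 0
    no-atom-below y with atomNotBelow? H y | y ⊑? A
    ... | no _ | _ = refl
    ... | yes (_ , y⋢H) | yes y⊑A = ⊥-elim (y⋢H (⊑-trans y⊑A A⊑H))
    ... | yes _ | no y⋢A = μ-⋢ y⋢A
  ... | no A⋢H = trans (cancel (μ L 𝟘 A) (∑μ-atomsNotBelow H A))
                      (cong (_- ∑μ-atomsNotBelow H A) (μ𝟘+∑atomsNotBelow≡0 H-coatom A⋢H))
    where
    cancel : ∀ a b → a ≡ (a + b) - b
    cancel = solve-∀

module Coefficients (L : FiniteModularComplementedLattice) (W : Weighting L) where

  open IncidenceAlgebra L
  open FiniteModularComplementedLattice L using ()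
    renaming (Carrier to C; _≤_ to _⊑_; _≤?_ to _⊑?_; 𝟎 to 𝟘; 𝟏 to 𝟙)
  open IsBoundedLattice (isBoundedLattice L) using (minimum; maximum)

  exponent≟ : ∀ A k → Dec (f W 𝟙 ∸ f W A ≡ k)
  exponent≟ A k = f W 𝟙 ∸ f W A ℕ.≟ k

  charPoly-coeff : ∀ X Y k → charPoly L W X Y k ≡
                   ∑[ A ∈ elems L ] [ X ⊑? A ]· [ A ⊑? Y ]· [ f W Y ∸ f W A ℕ.≟ k ]· μ L X A
  charPoly-coeff X Y k = trans (∑-filter _ (elems L) (μ L X)) (∑-cong (elems L) λ A →
    trans ([]·-×-dec ((X ⊑? A) ×-dec (A ⊑? Y)) (f W Y ∸ f W A ℕ.≟ k) (μ L X A))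
          ([]·-×-dec (X ⊑? A) (A ⊑? Y) _))

  P-contract-coeff : ∀ y k → P-contract L W y k ≡ ∑[ A ∈ elems L ] [ exponent≟ A k ]· μ L y A
  P-contract-coeff y k = trans (charPoly-coeff y 𝟙 k) (∑-cong (elems L) λ A → begin
    [ y ⊑? A ]· [ A ⊑? 𝟙 ]· [ exponent≟ A k ]· μ L y A
      ≡⟨ cong ([ y ⊑? A ]·_) ([]·-yes (maximum A) (A ⊑? 𝟙) _) ⟩
    [ y ⊑? A ]· [ exponent≟ A k ]· μ L y A
      ≡⟨ []·-comm (y ⊑? A) (exponent≟ A k) (μ L y A) ⟩
    [ exponent≟ A k ]· [ y ⊑? A ]· μ L y A
      ≡⟨ cong ([ exponent≟ A k ]·_) (μ-masked y A) ⟩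
    [ exponent≟ A k ]· μ L y A ∎)
    where open ≡-Reasoning

  z^-P-restrict-coeff : ∀ Y k → (z^ (f W 𝟙 ∸ f W Y) · P-restrict L W Y) k ≡
                        ∑[ A ∈ elems L ] [ A ⊑? Y ]· [ exponent≟ A k ]· μ L 𝟘 A
  z^-P-restrict-coeff Y k with k ℕ.<? f W 𝟙 ∸ f W Y
  ... | yes k<m = sym (∑-zero (elems L) λ A _ → vanishes A (A ⊑? Y))
    where
    vanishes : ∀ A (A⊑?Y : Dec (A ⊑ Y)) → [ A⊑?Y ]· [ exponent≟ A k ]· μ L 𝟘 A ≡ + 0
    vanishes A (no _) = refl
    vanishes A (yes A⊑Y) = []·-no (λ exponent≡k → ℕP.<⇒≱ k<m (subst (f W 𝟙 ∸ f W Y ℕ.≤_) exponent≡k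
                                                              (ℕP.∸-monoʳ-≤ (f W 𝟙) (monotone W A⊑Y))))
                                  (exponent≟ A k) (μ L 𝟘 A)
  ... | no k≮m = trans (charPoly-coeff 𝟘 Y (k ∸ (f W 𝟙 ∸ f W Y))) (∑-cong (elems L) λ A →
          trans ([]·-yes (minimum A) (𝟘 ⊑? A) _) (shift A (A ⊑? Y)))
    where
    shift : ∀ A (A⊑?Y : Dec (A ⊑ Y)) → [ A⊑?Y ]· [ f W Y ∸ f W A ℕ.≟ k ∸ (f W 𝟙 ∸ f W Y) ]· μ L 𝟘 A
                                       ≡ [ A⊑?Y ]· [ exponent≟ A k ]· μ L 𝟘 A
    shift A (no _) = refl
    shift A (yes A⊑Y) = []·-cong (∸-≡-shift (monotone W A⊑Y) (monotone W (maximum Y)) (ℕP.≮⇒≥ k≮m))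
                                 (f W Y ∸ f W A ℕ.≟ k ∸ (f W 𝟙 ∸ f W Y)) (exponent≟ A k) (μ L 𝟘 A)

  sumAtomsNotBelow-coeff : ∀ H k → sumAtomsNotBelow L W H k ≡
    ∑[ A ∈ elems L ] [ exponent≟ A k ]· ∑μ-atomsNotBelow H A
  sumAtomsNotBelow-coeff H k = begin
    sumAtomsNotBelow L W H k
      ≡⟨ ΣP-coeff (P-contract L W) (filter (atomNotBelow? H) (elems L)) k ⟩
    ∑[ y ∈ filter (atomNotBelow? H) (elems L) ] P-contract L W y k
      ≡⟨ ∑-filter (atomNotBelow? H) (elems L) _ ⟩
    ∑[ y ∈ elems L ] [ atomNotBelow? H y ]· P-contract L W y k
      ≡⟨ ∑-cong (elems L) (λ y → cong ([ atomNotBelow? H y ]·_) (P-contract-coeff y k)) ⟩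
    ∑[ y ∈ elems L ] [ atomNotBelow? H y ]· (∑[ A ∈ elems L ] [ exponent≟ A k ]· μ L y A)
      ≡⟨ ∑-cong (elems L) (λ y → []·-distrib-∑ (atomNotBelow? H y) (elems L) _) ⟩
    ∑[ y ∈ elems L ] ∑[ A ∈ elems L ] [ atomNotBelow? H y ]· [ exponent≟ A k ]· μ L y A
      ≡⟨ ∑-swap (elems L) (elems L) _ ⟩
    ∑[ A ∈ elems L ] ∑[ y ∈ elems L ] [ atomNotBelow? H y ]· [ exponent≟ A k ]· μ L y A
      ≡⟨ ∑-cong (elems L) (λ A → ∑-cong (elems L) λ y → []·-comm (atomNotBelow? H y) (exponent≟ A k) _) ⟩
    ∑[ A ∈ elems L ] ∑[ y ∈ elems L ] [ exponent≟ A k ]· [ atomNotBelow? H y ]· μ L y A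
      ≡⟨ ∑-cong (elems L) (λ A → sym ([]·-distrib-∑ (exponent≟ A k) (elems L) _)) ⟩
    ∑[ A ∈ elems L ] [ exponent≟ A k ]· ∑μ-atomsNotBelow H A ∎
    where open ≡-Reasoning

  P-coatom : ∀ {H} → IsCoatom L H →
             P L W ≈P ((z^ (f W 𝟙 ∸ f W H) · P-restrict L W H) ⊖ sumAtomsNotBelow L W H)
  P-coatom {H} H-coatom k = begin
    P L W k
      ≡⟨ P-contract-coeff 𝟘 k ⟩
    ∑[ A ∈ elems L ] [ exponent≟ A k ]· μ L 𝟘 A
      ≡⟨ ∑-cong (elems L) (λ A → cong ([ exponent≟ A k ]·_) (μ𝟘-coatom H-coatom A)) ⟩
    ∑[ A ∈ elems L ] [ exponent≟ A k ]· ([ A ⊑? H ]· μ L 𝟘 A - ∑μ-atomsNotBelow H A)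
      ≡⟨ ∑-cong (elems L) distribute ⟩
    ∑[ A ∈ elems L ] ([ A ⊑? H ]· [ exponent≟ A k ]· μ L 𝟘 A - [ exponent≟ A k ]· ∑μ-atomsNotBelow H A)
      ≡⟨ ∑-minus (elems L) _ _ ⟩
    (∑[ A ∈ elems L ] [ A ⊑? H ]· [ exponent≟ A k ]· μ L 𝟘 A)
      - (∑[ A ∈ elems L ] [ exponent≟ A k ]· ∑μ-atomsNotBelow H A)
      ≡⟨ sym (cong₂ _-_ (z^-P-restrict-coeff H k) (sumAtomsNotBelow-coeff H k)) ⟩
    ((z^ (f W 𝟙 ∸ f W H) · P-restrict L W H) ⊖ sumAtomsNotBelow L W H) k ∎
    where
    open ≡-Reasoning
    distribute : ∀ A → [ exponent≟ A k ]· ([ A ⊑? H ]· μ L 𝟘 A - ∑μ-atomsNotBelow H A)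
                       ≡ [ A ⊑? H ]· [ exponent≟ A k ]· μ L 𝟘 A - [ exponent≟ A k ]· ∑μ-atomsNotBelow H A
    distribute A = trans ([]·-distrib-minus (exponent≟ A k) ([ A ⊑? H ]· μ L 𝟘 A) (∑μ-atomsNotBelow H A))
                         (cong (_- [ exponent≟ A k ]· ∑μ-atomsNotBelow H A) ([]·-comm (exponent≟ A k) (A ⊑? H) _))

  nonFlat-coatom⇒f𝟙≤fH : ∀ {H} → IsCoatom L H → ¬ IsFlat L W H → f W 𝟙 ℕ.≤ f W H
  nonFlat-coatom⇒f𝟙≤fH {H} (_ , nothing-above) ¬flat with f W H ℕ.<? f W 𝟙
  ... | no fH≮f𝟙 = ℕP.≮⇒≥ fH≮f𝟙
  ... | yes fH<f𝟙 = ⊥-elim (¬flat flat)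
    where
    flat : IsFlat L W H
    flat A H⊏A with _≟_ L A 𝟙
    ... | yes refl = fH<f𝟙
    ... | no A≢𝟙 = ⊥-elim (nothing-above A (H⊏A , (maximum A , A≢𝟙)))

corollary3p3 : (L : FiniteModularComplementedLattice) (W : Weighting L)
    (H : Carrier L) → IsCoatom L H →
    (P L W ≈P ((z^ (f W (𝟏 L) ∸ f W H) · P-restrict L W H) ⊖ sumAtomsNotBelow L W H))
    × (¬ IsFlat L W H →
       P L W ≈P (P-restrict L W H ⊖ sumAtomsNotBelow L W H))
corollary3p3 L W H H-coatom = P-coatom H-coatom , λ ¬flat k → begin
  P L W k
    ≡⟨ P-coatom H-coatom k ⟩
  (z^ (f W (𝟏 L) ∸ f W H) · P-restrict L W H) k - sumAtomsNotBelow L W H k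
    ≡⟨ cong (λ m → (z^ m · P-restrict L W H) k - sumAtomsNotBelow L W H k)
            (ℕP.m≤n⇒m∸n≡0 (nonFlat-coatom⇒f𝟙≤fH H-coatom ¬flat)) ⟩
  (z^ 0 · P-restrict L W H) k - sumAtomsNotBelow L W H k
    ≡⟨ cong (_- sumAtomsNotBelow L W H k) (z^0-identity (P-restrict L W H) k) ⟩
  P-restrict L W H k - sumAtomsNotBelow L W H k ∎
  where
  open Coefficients L W
  open ≡-Reasoning
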